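{- Let $G$ be an Eulerian graph on an even number $n$ of vertices, and let $A$ be its adjacency matrix regarded over $\mathbb{F}_2$. Let $\mathbb{F}$ be the splitting field over $\mathbb{F}_2$ of the characteristic polynomial of $A$, and let $A=PJP^{ -1}$ with $P\in M_{n\times n}(\mathbb{F})$ invertible and $J=\mathrm{diag}(J_1,\ldots,J_t)$ a Jordan normal form of $A$ over $\mathbb{F}$, where $J_i$ is the $\ell_i\times\ell_i$ Jordan block with eigenvalue $\lambda_i$ (so, writing the columns of $P$ as $\alpha_{11},\ldots,\alpha_{1\ell_1},\ldots,\alpha_{t1},\ldots,\alpha_{t\ell_t}$, we have $A\alpha_{i1}=\lambda_i\alpha_{i1}$ and $A\alpha_{i,k+1}=\lambda_i\alpha_{i,k+1}+\alpha_{ik}$ for $1\le k<\ell_i$), and where $\alpha_{11}=e$ is the all-one vector (so $\lambda_1=0$). Let $Q=P^{\rm T}P$, partitioned into blocks $Q_{ij}$ (of size $\ell_i\times\ell_j$) conformally with $J$. Then $Q_{11}=0$.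
   Context: An Eulerian graph is a connected graph in which every vertex has even degree. Since all degrees are even, $Ae=0$ over $\mathbb{F}_2$, so $e$ can be chosen as the first column of $P$ in a Jordan block for eigenvalue $0$. -}

module Defs where

open import Level using (Level; _⊔_; suc)
open import Data.Nat as ℕ using (ℕ; zero; _<_; _≤_)
open import Data.Nat.Divisibility using (_∣_)
open import Data.Fin using (Fin; toℕ)
import Data.Fin as Fin
open import Data.Bool using (Bool; true; false; if_then_else_)
open import Data.List using (List; []; _∷_)
open import Data.List.Relation.Unary.All using (All)
open import Data.Product using (_×_; _,_; ∃; proj₁)
open import Relation.Nullary using (¬_; yes; no)
open import Relation.Binary.PropositionalEquality using (_≡_)
open import Algebra.Bundles using (CommutativeRing)

record Field (c ℓ : Level) : Set (suc (c ⊔ ℓ)) where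
  field
    commutativeRing : CommutativeRing c ℓ
  open CommutativeRing commutativeRing public
  field
    1≉0     : ¬ (1# ≈ 0#)
    inverse : ∀ x → ¬ (x ≈ 0#) → ∃ λ y → x * y ≈ 1#

-- characteristic 2, i.e. F contains F₂ = {0,1} as prime field
HasChar2 : ∀ {c ℓ} → Field c ℓ → Set ℓ
HasChar2 F = (1# + 1#) ≈ 0#
  where open Field F

record SimpleGraph (n : ℕ) : Set where
  field
    adj   : Fin n → Fin n → Bool
    symm  : ∀ i j → adj i j ≡ adj j i
    irrefl : ∀ i → adj i i ≡ false
open SimpleGraph public

sumℕ : ∀ {n} → (Fin n → ℕ) → ℕ
sumℕ {zero}  f = 0
sumℕ {ℕ.suc n} f = f Fin.zero ℕ.+ sumℕ (λ i → f (Fin.suc i))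

degree : ∀ {n} → SimpleGraph n → Fin n → ℕ
degree G i = sumℕ (λ j → if adj G i j then 1 else 0)

data Reachable {n} (G : SimpleGraph n) : Fin n → Fin n → Set where
  here : ∀ {i} → Reachable G i i
  step : ∀ {i j k} → adj G i j ≡ true → Reachable G j k → Reachable G i k

Connected : ∀ {n} → SimpleGraph n → Set
Connected G = ∀ i j → Reachable G i j

Eulerian : ∀ {n} → SimpleGraph n → Set
Eulerian G = Connected G × (∀ i → 2 ∣ degree G i)

module Matrices {c ℓ} (F : Field c ℓ) where
  open Field F

  Matrix : ℕ → ℕ → Set c
  Matrix m k = Fin m → Fin k → Carrier

  sumF : ∀ {n} → (Fin n → Carrier) → Carrier
  sumF {zero}    f = 0#
  sumF {ℕ.suc n} f = f Fin.zero + sumF (λ i → f (Fin.suc i))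

  _⊗_ : ∀ {m k p} → Matrix m k → Matrix k p → Matrix m p
  (M ⊗ N) i j = sumF (λ r → M i r * N r j)

  transpose : ∀ {m k} → Matrix m k → Matrix k m
  transpose M i j = M j i

  identity : ∀ {n} → Matrix n n
  identity i j with i Fin.≟ j
  ... | yes _ = 1#
  ... | no  _ = 0#

  _≋_ : ∀ {m k} → Matrix m k → Matrix m k → Set ℓ
  M ≋ N = ∀ i j → M i j ≈ N i j

  Invertible : ∀ {n} → Matrix n n → Set (c ⊔ ℓ)
  Invertible {n} M = ∃ λ (N : Matrix n n) → (M ⊗ N) ≋ identity × (N ⊗ M) ≋ identity

  adjMatrix : ∀ {n} → SimpleGraph n → Matrix n n
  adjMatrix G i j = if adj G i j then 1# else 0#

  -- Jordan block list: each entry (ℓᵢ , λᵢ) is an ℓᵢ × ℓᵢ Jordan block with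
  -- eigenvalue λᵢ (λᵢ on the diagonal, 1 on the superdiagonal).
  -- blockDiag bs r c is the (r,c) entry (0-indexed) of diag(J₁,…,J_t).
  blockDiag : List (ℕ × Carrier) → ℕ → ℕ → Carrier
  blockDiag [] r c = 0#
  blockDiag ((l , λ′) ∷ bs) r c with r ℕ.<? l | c ℕ.<? l
  ... | yes _ | yes _ with r ℕ.≟ c | ℕ.suc r ℕ.≟ c
  ...   | yes _ | _     = λ′
  ...   | no _  | yes _ = 1#
  ...   | no _  | no _  = 0#
  blockDiag ((l , λ′) ∷ bs) r c | no _ | no _ = blockDiag bs (r ℕ.∸ l) (c ℕ.∸ l)
  blockDiag ((l , λ′) ∷ bs) r c | _ | _ = 0#

  jordanMatrix : ∀ {n} → List (ℕ × Carrier) → Matrix n n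
  jordanMatrix bs i j = blockDiag bs (toℕ i) (toℕ j)

  blockSizeSum : List (ℕ × Carrier) → ℕ
  blockSizeSum [] = 0
  blockSizeSum ((l , _) ∷ bs) = l ℕ.+ blockSizeSum bs

  ValidBlocks : ℕ → List (ℕ × Carrier) → Set c
  ValidBlocks n bs = All (λ b → 1 ≤ proj₁ b) bs × blockSizeSum bs ≡ n

{-# OPTIONS --safe #-}
-- Write ⟨x , y⟩ = Σᵢ xᵢ yᵢ, so that (Pᵀ P) a b = ⟨α a , α b⟩ for the columns α of P,
-- and e for the all-one vector. In characteristic 2, ⟨x , x⟩ = ⟨e , x⟩², and as A is
-- symmetric with zero diagonal, ⟨A x , x⟩ = 0; as all degrees are even, A e = 0.
-- Together these give ⟨Aᵈ x , x⟩ = 0 for every d ≥ 1: moving one factor A to the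
-- right lowers d by two, ending at ⟨A x , x⟩ = 0 or at ⟨A x , A x⟩ = ⟨e , A x⟩² =
-- ⟨A e , x⟩² = 0. The first Jordan block has eigenvalue 0 (because α 0 = e and
-- A e = 0), so A α (k + 1) = α k, hence ⟨α k , α m⟩ = ⟨Aᵐ⁻ᵏ (α m) , α m⟩ = 0 for
-- k < m. Finally ⟨α m , α m⟩ = ⟨α 0 , α m⟩² vanishes by that case when m > 0, and
-- ⟨e , e⟩ = n = 0 because n is even.

module Submission where

open import Defs
open import Data.Nat using (ℕ; _<_)
open import Data.Nat.Divisibility using (_∣_)
open import Data.Fin using (Fin; toℕ)
open import Data.List using (List; _∷_)
open import Data.Product using (_×_; _,_)
open import Relation.Binary.PropositionalEquality using (_≡_)

open import Data.Nat using (zero; suc; z≤n; _<?_; _≟_)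
import Data.Nat as ℕ
import Data.Nat.Properties as ℕ
open import Data.Nat.Divisibility using (divides)
open import Data.Nat.GeneralisedArithmetic using (iterate; iterate-is-fold)
open import Data.Fin using (zero; suc; fromℕ<)
open import Data.Fin.Properties using (toℕ-injective; toℕ-fromℕ<; toℕ<n; suc-injective)
open import Data.Vec.Functional using (Vector; replicate)
open import Data.Bool using (true; false; if_then_else_)
open import Data.Sum using (inj₁; inj₂)
open import Relation.Binary.Definitions using (tri<; tri≈; tri>)
open import Function using (_∘_)
open import Relation.Nullary using (yes; no; contradiction)
open import Relation.Binary.PropositionalEquality using (_≢_)
import Relation.Binary.PropositionalEquality as ≡
import Algebra.Properties.Semiring.Sum as SemiringSum
import Algebra.Properties.Monoid.Mult as MonoidMult
import Data.Vec.Functional.Relation.Binary.Equality.Setoid as VectorEquality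
import Relation.Binary.Reasoning.Setoid as SetoidReasoning

iterate-sucʳ : ∀ {a} {A : Set a} (f : A → A) x d → iterate f x (suc d) ≡ f (iterate f x d)
iterate-sucʳ f x d =
  ≡.trans (≡.sym (iterate-is-fold x f (suc d))) (≡.cong f (iterate-is-fold x f d))

module _ {c ℓ} (F : Field c ℓ) where
  open Field F hiding (zero)
  open Matrices F
  open SemiringSum semiring
    using (sum; sum-cong-≋; sum-replicate; sum-replicate-zero; ∑-comm; ∑-distrib-+; *-distribˡ-sum; *-distribʳ-sum)
  open MonoidMult +-monoid using (×-homo-+) renaming (_×_ to _·ℕ_)
  open VectorEquality setoid using () renaming (_≋_ to _≋ᵥ_)
  open SetoidReasoning setoid

  infixr 7 _·ᵥ_

  _·ᵥ_ : ∀ {m k} → Matrix m k → Vector Carrier k → Vector Carrier m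
  (M ·ᵥ x) i = sum λ j → M i j * x j

  _^_·ᵥ_ : ∀ {n} → Matrix n n → ℕ → Vector Carrier n → Vector Carrier n
  M ^ d ·ᵥ x = iterate (M ·ᵥ_) x d

  ⟨_,_⟩ : ∀ {n} → Vector Carrier n → Vector Carrier n → Carrier
  ⟨ x , y ⟩ = sum λ i → x i * y i

  column : ∀ {m k} → Matrix m k → Fin k → Vector Carrier m
  column M j i = M i j

  ones : ∀ {n} → Vector Carrier n
  ones {n} = replicate n 1#

  sumF≡sum : ∀ {n} (f : Vector Carrier n) → sumF f ≡ sum f
  sumF≡sum {zero}  f = ≡.refl
  sumF≡sum {suc n} f = ≡.cong (f zero +_) (sumF≡sum (f ∘ suc))

  ⊗-column : ∀ {m k p} (M : Matrix m k) (N : Matrix k p) i j → (M ⊗ N) i j ≈ (M ·ᵥ column N j) i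
  ⊗-column M N i j = reflexive (sumF≡sum λ r → M i r * N r j)

  transpose-⊗-gram : ∀ {m k} (M : Matrix m k) i j → (transpose M ⊗ M) i j ≈ ⟨ column M i , column M j ⟩
  transpose-⊗-gram M i j = reflexive (sumF≡sum λ r → M r i * M r j)

  sum≈0 : ∀ {n} {f : Vector Carrier n} → (∀ i → f i ≈ 0#) → sum f ≈ 0#
  sum≈0 {n} f≈0 = trans (sum-cong-≋ f≈0) (sum-replicate-zero n)

  sum-single : ∀ {n} (f : Vector Carrier n) i → (∀ k → k ≢ i → f k ≈ 0#) → sum f ≈ f i
  sum-single f zero    f≈0 = trans (+-congˡ (sum≈0 λ k → f≈0 (suc k) λ ())) (+-identityʳ _)
  sum-single f (suc i) f≈0 =
    trans (+-cong (f≈0 zero λ ()) (sum-single (f ∘ suc) i λ k k≢i → f≈0 (suc k) (k≢i ∘ suc-injective)))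
          (+-identityˡ _)

  sum-pair : ∀ {n} (f : Vector Carrier n) {i j} → i ≢ j →
             (∀ k → k ≢ i → k ≢ j → f k ≈ 0#) → sum f ≈ f i + f j
  sum-pair f {zero}  {zero}  i≢j f≈0 = contradiction ≡.refl i≢j
  sum-pair f {zero}  {suc j} i≢j f≈0 =
    +-congˡ (sum-single (f ∘ suc) j λ k k≢j → f≈0 (suc k) (λ ()) (k≢j ∘ suc-injective))
  sum-pair f {suc i} {zero}  i≢j f≈0 =
    trans (+-congˡ (sum-single (f ∘ suc) i λ k k≢i → f≈0 (suc k) (k≢i ∘ suc-injective) (λ ())))
          (+-comm _ _)
  sum-pair f {suc i} {suc j} i≢j f≈0 =
    trans (+-cong (f≈0 zero (λ ()) (λ ()))
                  (sum-pair (f ∘ suc) (i≢j ∘ ≡.cong suc) λ k k≢i k≢j →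
                     f≈0 (suc k) (k≢i ∘ suc-injective) (k≢j ∘ suc-injective)))
          (+-identityˡ _)

  sum-·ℕ : ∀ {n} (f : Fin n → ℕ) x → sum (λ i → f i ·ℕ x) ≈ sumℕ f ·ℕ x
  sum-·ℕ {zero}  f x = refl
  sum-·ℕ {suc n} f x = trans (+-congˡ (sum-·ℕ (f ∘ suc) x)) (sym (×-homo-+ x (f zero) (sumℕ (f ∘ suc))))

  ·ᵥ-congʳ : ∀ {m k} (M : Matrix m k) {x y} → x ≋ᵥ y → M ·ᵥ x ≋ᵥ M ·ᵥ y
  ·ᵥ-congʳ M x≋y i = sum-cong-≋ λ j → *-congˡ (x≋y j)

  ·ᵥ-congˡ : ∀ {m k} {M N : Matrix m k} → M ≋ N → ∀ x → M ·ᵥ x ≋ᵥ N ·ᵥ x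
  ·ᵥ-congˡ M≋N x i = sum-cong-≋ λ j → *-congʳ (M≋N i j)

  ^·ᵥ-congʳ : ∀ {n} (M : Matrix n n) d {x y} → x ≋ᵥ y → M ^ d ·ᵥ x ≋ᵥ M ^ d ·ᵥ y
  ^·ᵥ-congʳ M zero    x≋y = x≋y
  ^·ᵥ-congʳ M (suc d) x≋y = ^·ᵥ-congʳ M d (·ᵥ-congʳ M x≋y)

  ⟨⟩-cong : ∀ {n} {x x′ y y′ : Vector Carrier n} → x ≋ᵥ x′ → y ≋ᵥ y′ → ⟨ x , y ⟩ ≈ ⟨ x′ , y′ ⟩
  ⟨⟩-cong x≋x′ y≋y′ = sum-cong-≋ λ i → *-cong (x≋x′ i) (y≋y′ i)

  ⟨⟩-comm : ∀ {n} (x y : Vector Carrier n) → ⟨ x , y ⟩ ≈ ⟨ y , x ⟩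
  ⟨⟩-comm x y = sum-cong-≋ λ i → *-comm (x i) (y i)

  ⟨⟩-zeroˡ : ∀ {n} {x : Vector Carrier n} y → (∀ i → x i ≈ 0#) → ⟨ x , y ⟩ ≈ 0#
  ⟨⟩-zeroˡ y x≈0 = sum≈0 λ i → trans (*-congʳ (x≈0 i)) (zeroˡ (y i))

  ⟨ones,⟩≈sum : ∀ {n} (x : Vector Carrier n) → ⟨ ones , x ⟩ ≈ sum x
  ⟨ones,⟩≈sum x = sum-cong-≋ λ i → *-identityˡ (x i)

  ⟨·ᵥ,⟩≈⟨,transpose·ᵥ⟩ : ∀ {m k} (M : Matrix m k) x y → ⟨ M ·ᵥ x , y ⟩ ≈ ⟨ x , transpose M ·ᵥ y ⟩
  ⟨·ᵥ,⟩≈⟨,transpose·ᵥ⟩ M x y = begin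
    sum (λ i → sum (λ j → M i j * x j) * y i)
      ≈⟨ sum-cong-≋ (λ i → *-distribʳ-sum (y i) λ j → M i j * x j) ⟩
    sum (λ i → sum (λ j → M i j * x j * y i))
      ≈⟨ ∑-comm (λ i j → M i j * x j * y i) ⟩
    sum (λ j → sum (λ i → M i j * x j * y i))
      ≈⟨ sum-cong-≋ (λ j → sum-cong-≋ λ i → rearrange (M i j) (x j) (y i)) ⟩
    sum (λ j → sum (λ i → x j * (M i j * y i)))
      ≈⟨ sum-cong-≋ (λ j → sym (*-distribˡ-sum (x j) λ i → M i j * y i)) ⟩
    sum (λ j → x j * sum (λ i → M i j * y i))
      ∎
    where
    rearrange : ∀ a b c → a * b * c ≈ b * (a * c)
    rearrange a b c = trans (*-congʳ (*-comm a b)) (*-assoc b a c)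

  ⟨·ᵥ,⟩≈⟨,·ᵥ⟩ : ∀ {n} {A : Matrix n n} → (∀ i j → A i j ≈ A j i) →
                ∀ x y → ⟨ A ·ᵥ x , y ⟩ ≈ ⟨ x , A ·ᵥ y ⟩
  ⟨·ᵥ,⟩≈⟨,·ᵥ⟩ {A = A} A-sym x y =
    trans (⟨·ᵥ,⟩≈⟨,transpose·ᵥ⟩ A x y) (⟨⟩-cong (λ _ → refl) (·ᵥ-congˡ (λ i j → A-sym j i) y))

  module _ (l : ℕ) (λ′ : Carrier) (bs : List (ℕ × Carrier)) where

    blockDiag-diagonal : ∀ r → r < l → blockDiag ((l , λ′) ∷ bs) r r ≡ λ′
    blockDiag-diagonal r r<l with r <? l | r <? l
    ... | yes _ | yes _ with r ≟ r | suc r ≟ r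
    ...   | yes _   | _ = ≡.refl
    ...   | no r≢r  | _ = contradiction ≡.refl r≢r
    blockDiag-diagonal r r<l | no r≮l | _     = contradiction r<l r≮l
    blockDiag-diagonal r r<l | yes _  | no r≮l = contradiction r<l r≮l

    blockDiag-superdiagonal : ∀ r c → suc r ≡ c → c < l → blockDiag ((l , λ′) ∷ bs) r c ≡ 1#
    blockDiag-superdiagonal r c 1+r≡c c<l with r <? l | c <? l
    ... | yes _ | yes _ with r ≟ c | suc r ≟ c
    ...   | yes r≡c | _         = contradiction (≡.trans 1+r≡c (≡.sym r≡c)) (ℕ.1+n≢n)
    ...   | no _    | yes _     = ≡.refl
    ...   | no _    | no 1+r≢c  = contradiction 1+r≡c 1+r≢c
    blockDiag-superdiagonal r c 1+r≡c c<l | no r≮l | _ =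
      contradiction (ℕ.<-trans (ℕ.n<1+n r) (≡.subst (_< l) (≡.sym 1+r≡c) c<l)) r≮l
    blockDiag-superdiagonal r c 1+r≡c c<l | yes _ | no c≮l = contradiction c<l c≮l

    blockDiag-off : ∀ r c → r ≢ c → suc r ≢ c → c < l → blockDiag ((l , λ′) ∷ bs) r c ≡ 0#
    blockDiag-off r c r≢c 1+r≢c c<l with r <? l | c <? l
    ... | yes _ | yes _ with r ≟ c | suc r ≟ c
    ...   | yes r≡c | _         = contradiction r≡c r≢c
    ...   | no _    | yes 1+r≡c = contradiction 1+r≡c 1+r≢c
    ...   | no _    | no _      = ≡.refl
    blockDiag-off r c r≢c 1+r≢c c<l | no _  | yes _  = ≡.refl
    blockDiag-off r c r≢c 1+r≢c c<l | _     | no c≮l = contradiction c<l c≮l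

    module _ {n} (M : Matrix n n) where

      ⊗-jordan-leading : ∀ r j → toℕ j ≡ 0 → toℕ j < l →
                         (M ⊗ jordanMatrix ((l , λ′) ∷ bs)) r j ≈ M r j * λ′
      ⊗-jordan-leading r j j≡0 j<l = begin
        (M ⊗ J) r j                ≈⟨ ⊗-column M J r j ⟩
        sum (λ k → M r k * J k j)  ≈⟨ sum-single _ j off ⟩
        M r j * J j j              ≡⟨ ≡.cong (M r j *_) (blockDiag-diagonal (toℕ j) j<l) ⟩
        M r j * λ′                 ∎
        where
        J : Matrix n n
        J = jordanMatrix ((l , λ′) ∷ bs)
        off : ∀ k → k ≢ j → M r k * J k j ≈ 0#
        off k k≢j = trans (*-congˡ (reflexive (blockDiag-off (toℕ k) (toℕ j)
                      (k≢j ∘ toℕ-injective) (λ 1+k≡j → ℕ.1+n≢0 (≡.trans 1+k≡j j≡0)) j<l)))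
                      (zeroʳ _)

      ⊗-jordan-chain : ∀ r i j → toℕ j ≡ suc (toℕ i) → toℕ j < l →
                       (M ⊗ jordanMatrix ((l , λ′) ∷ bs)) r j ≈ M r j * λ′ + M r i
      ⊗-jordan-chain r i j j≡1+i j<l = begin
        (M ⊗ J) r j                   ≈⟨ ⊗-column M J r j ⟩
        sum (λ k → M r k * J k j)     ≈⟨ sum-pair _ j≢i off ⟩
        M r j * J j j + M r i * J i j ≡⟨ ≡.cong₂ (λ a b → M r j * a + M r i * b)
                                           (blockDiag-diagonal (toℕ j) j<l)
                                           (blockDiag-superdiagonal (toℕ i) (toℕ j) (≡.sym j≡1+i) j<l) ⟩
        M r j * λ′ + M r i * 1#       ≈⟨ +-congˡ (*-identityʳ _) ⟩
        M r j * λ′ + M r i            ∎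
        where
        J : Matrix n n
        J = jordanMatrix ((l , λ′) ∷ bs)
        j≢i : j ≢ i
        j≢i j≡i = ℕ.1+n≢n (≡.trans (≡.sym j≡1+i) (≡.cong toℕ j≡i))
        off : ∀ k → k ≢ j → k ≢ i → M r k * J k j ≈ 0#
        off k k≢j k≢i = trans (*-congˡ (reflexive (blockDiag-off (toℕ k) (toℕ j)
                          (k≢j ∘ toℕ-injective)
                          (λ 1+k≡j → k≢i (toℕ-injective (ℕ.suc-injective (≡.trans 1+k≡j j≡1+i)))) j<l)))
                          (zeroʳ _)

  module _ {n} (G : SimpleGraph n) where

    adjMatrix-symmetric : ∀ i j → adjMatrix G i j ≈ adjMatrix G j i
    adjMatrix-symmetric i j = reflexive (≡.cong (λ b → if b then 1# else 0#) (symm G i j))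

    adjMatrix-diagonal : ∀ i → adjMatrix G i i ≈ 0#
    adjMatrix-diagonal i = reflexive (≡.cong (λ b → if b then 1# else 0#) (irrefl G i))

    adjMatrix-row-sum : ∀ i → (adjMatrix G ·ᵥ ones) i ≈ degree G i ·ℕ 1#
    adjMatrix-row-sum i =
      trans (sum-cong-≋ λ j → indicator (adj G i j)) (sum-·ℕ (λ j → if adj G i j then 1 else 0) 1#)
      where
      indicator : ∀ b → (if b then 1# else 0#) * 1# ≈ (if b then 1 else 0) ·ℕ 1#
      indicator true  = trans (*-identityʳ 1#) (sym (+-identityʳ 1#))
      indicator false = zeroˡ 1#

  module _ {n} (A P : Matrix n n) (l : ℕ) (λ′ : Carrier) (bs : List (ℕ × Carrier))
           (AP≋PJ : (A ⊗ P) ≋ (P ⊗ jordanMatrix ((l , λ′) ∷ bs))) where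

    jordan-leading-eigenvalue≈0 : (∀ i → (A ·ᵥ ones) i ≈ 0#) → (∀ r k → toℕ k ≡ 0 → P r k ≈ 1#) →
                                  0 < n → 0 < l → λ′ ≈ 0#
    jordan-leading-eigenvalue≈0 Ae≈0 leading-ones 0<n 0<l = begin
      λ′                                        ≈⟨ *-identityˡ λ′ ⟨
      1# * λ′                                   ≈⟨ *-congʳ (leading-ones j₀ j₀ j₀≡0) ⟨
      P j₀ j₀ * λ′                              ≈⟨ ⊗-jordan-leading l λ′ bs P j₀ j₀ j₀≡0 j₀<l ⟨
      (P ⊗ jordanMatrix ((l , λ′) ∷ bs)) j₀ j₀  ≈⟨ AP≋PJ j₀ j₀ ⟨
      (A ⊗ P) j₀ j₀                             ≈⟨ ⊗-column A P j₀ j₀ ⟩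
      (A ·ᵥ column P j₀) j₀                     ≈⟨ ·ᵥ-congʳ A (λ r → leading-ones r j₀ j₀≡0) j₀ ⟩
      (A ·ᵥ ones) j₀                            ≈⟨ Ae≈0 j₀ ⟩
      0#                                        ∎
      where
      j₀ : Fin n
      j₀ = fromℕ< 0<n
      j₀≡0 : toℕ j₀ ≡ 0
      j₀≡0 = toℕ-fromℕ< 0<n
      j₀<l : toℕ j₀ < l
      j₀<l = ≡.subst (_< l) (≡.sym j₀≡0) 0<l

    jordan-chain : λ′ ≈ 0# → ∀ i j → toℕ j ≡ suc (toℕ i) → toℕ j < l →
                   A ·ᵥ column P j ≋ᵥ column P i
    jordan-chain λ′≈0 i j j≡1+i j<l r = begin
      (A ·ᵥ column P j) r                      ≈⟨ ⊗-column A P r j ⟨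
      (A ⊗ P) r j                              ≈⟨ AP≋PJ r j ⟩
      (P ⊗ jordanMatrix ((l , λ′) ∷ bs)) r j   ≈⟨ ⊗-jordan-chain l λ′ bs P r i j j≡1+i j<l ⟩
      P r j * λ′ + P r i                       ≈⟨ +-congʳ (trans (*-congˡ λ′≈0) (zeroʳ _)) ⟩
      0# + P r i                               ≈⟨ +-identityˡ _ ⟩
      P r i                                    ∎

  module _ (char2 : HasChar2 F) where

    x+x≈0 : ∀ x → x + x ≈ 0#
    x+x≈0 x = begin
      x + x            ≈⟨ +-cong (*-identityˡ x) (*-identityˡ x) ⟨
      1# * x + 1# * x  ≈⟨ distribʳ x 1# 1# ⟨
      (1# + 1#) * x    ≈⟨ *-congʳ char2 ⟩
      0# * x           ≈⟨ zeroˡ x ⟩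
      0#               ∎

    even-·ℕ≈0 : ∀ {m} x → 2 ∣ m → m ·ℕ x ≈ 0#
    even-·ℕ≈0 x (divides q ≡.refl) = double≈0 q
      where
      double≈0 : ∀ q → (q ℕ.* 2) ·ℕ x ≈ 0#
      double≈0 zero    = refl
      double≈0 (suc q) = trans (sym (+-assoc x x _)) (trans (+-cong (x+x≈0 x) (double≈0 q)) (+-identityˡ 0#))

    eulerian-row-sum≈0 : ∀ {n} (G : SimpleGraph n) → Eulerian G → ∀ i → (adjMatrix G ·ᵥ ones) i ≈ 0#
    eulerian-row-sum≈0 G (_ , even-degree) i = trans (adjMatrix-row-sum G i) (even-·ℕ≈0 1# (even-degree i))

    square-+ : ∀ x y → (x + y) * (x + y) ≈ x * x + y * y
    square-+ x y = begin
      (x + y) * (x + y)                  ≈⟨ distribʳ (x + y) x y ⟩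
      x * (x + y) + y * (x + y)          ≈⟨ +-cong (distribˡ x x y) (distribˡ y x y) ⟩
      (x * x + x * y) + (y * x + y * y)  ≈⟨ +-assoc _ _ _ ⟩
      x * x + (x * y + (y * x + y * y))  ≈⟨ +-congˡ (+-assoc _ _ _) ⟨
      x * x + ((x * y + y * x) + y * y)  ≈⟨ +-congˡ (+-congʳ (trans (+-congˡ (*-comm y x)) (x+x≈0 _))) ⟩
      x * x + (0# + y * y)               ≈⟨ +-congˡ (+-identityˡ _) ⟩
      x * x + y * y                      ∎

    ⟨x,x⟩≈sum² : ∀ {n} (x : Vector Carrier n) → ⟨ x , x ⟩ ≈ sum x * sum x
    ⟨x,x⟩≈sum² {zero}  x = sym (zeroˡ 0#)
    ⟨x,x⟩≈sum² {suc n} x = trans (+-congˡ (⟨x,x⟩≈sum² (x ∘ suc))) (sym (square-+ (x zero) (sum (x ∘ suc))))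

    sum-symmetric-zero-diagonal : ∀ {n} (g : Fin n → Fin n → Carrier) → (∀ i j → g i j ≈ g j i) →
                                  (∀ i → g i i ≈ 0#) → sum (λ i → sum (g i)) ≈ 0#
    sum-symmetric-zero-diagonal {zero}  g g-sym g-diag = refl
    sum-symmetric-zero-diagonal {suc n} g g-sym g-diag = begin
      (g zero zero + X) + sum (λ i → g (suc i) zero + sum (g′ i))
        ≈⟨ +-cong (+-congʳ (g-diag zero)) (∑-distrib-+ (λ i → g (suc i) zero) (λ i → sum (g′ i))) ⟩
      (0# + X) + (sum (λ i → g (suc i) zero) + sum (λ i → sum (g′ i)))
        ≈⟨ +-cong (+-identityˡ X) (+-cong (sum-cong-≋ λ i → g-sym (suc i) zero)
             (sum-symmetric-zero-diagonal g′ (λ i j → g-sym (suc i) (suc j)) (g-diag ∘ suc))) ⟩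
      X + (X + 0#)  ≈⟨ +-congˡ (+-identityʳ X) ⟩
      X + X         ≈⟨ x+x≈0 X ⟩
      0#            ∎
      where
      X : Carrier
      X = sum (λ j → g zero (suc j))
      g′ : Fin n → Fin n → Carrier
      g′ i j = g (suc i) (suc j)

    module _ {n} (A : Matrix n n) (A-sym : ∀ i j → A i j ≈ A j i) (A-diag : ∀ i → A i i ≈ 0#)
             (Ae≈0 : ∀ i → (A ·ᵥ ones) i ≈ 0#) where

      ⟨·ᵥx,x⟩≈0 : ∀ x → ⟨ A ·ᵥ x , x ⟩ ≈ 0#
      ⟨·ᵥx,x⟩≈0 x = begin
        sum (λ i → (A ·ᵥ x) i * x i)  ≈⟨ sum-cong-≋ (λ i → *-distribʳ-sum (x i) λ j → A i j * x j) ⟩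
        sum (λ i → sum (g i))         ≈⟨ sum-symmetric-zero-diagonal g g-sym g-diag ⟩
        0#                            ∎
        where
        g : Fin n → Fin n → Carrier
        g i j = A i j * x j * x i
        g-sym : ∀ i j → g i j ≈ g j i
        g-sym i j = begin
          A i j * x j * x i    ≈⟨ *-assoc _ _ _ ⟩
          A i j * (x j * x i)  ≈⟨ *-cong (A-sym i j) (*-comm _ _) ⟩
          A j i * (x i * x j)  ≈⟨ *-assoc _ _ _ ⟨
          A j i * x i * x j    ∎
        g-diag : ∀ i → g i i ≈ 0#
        g-diag i = trans (*-congʳ (trans (*-congʳ (A-diag i)) (zeroˡ _))) (zeroˡ _)

      sum-·ᵥ≈0 : ∀ x → sum (A ·ᵥ x) ≈ 0#
      sum-·ᵥ≈0 x = begin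
        sum (A ·ᵥ x)        ≈⟨ ⟨ones,⟩≈sum (A ·ᵥ x) ⟨
        ⟨ ones , A ·ᵥ x ⟩   ≈⟨ ⟨·ᵥ,⟩≈⟨,·ᵥ⟩ A-sym ones x ⟨
        ⟨ A ·ᵥ ones , x ⟩   ≈⟨ ⟨⟩-zeroˡ x Ae≈0 ⟩
        0#                  ∎

      ⟨^·ᵥx,x⟩≈0 : ∀ d x → ⟨ A ^ suc d ·ᵥ x , x ⟩ ≈ 0#
      ⟨^·ᵥx,x⟩≈0 zero          x = ⟨·ᵥx,x⟩≈0 x
      ⟨^·ᵥx,x⟩≈0 (suc zero)    x = begin
        ⟨ A ·ᵥ A ·ᵥ x , x ⟩              ≈⟨ ⟨·ᵥ,⟩≈⟨,·ᵥ⟩ A-sym (A ·ᵥ x) x ⟩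
        ⟨ A ·ᵥ x , A ·ᵥ x ⟩              ≈⟨ ⟨x,x⟩≈sum² (A ·ᵥ x) ⟩
        sum (A ·ᵥ x) * sum (A ·ᵥ x)      ≈⟨ *-congʳ (sum-·ᵥ≈0 x) ⟩
        0# * sum (A ·ᵥ x)                ≈⟨ zeroˡ _ ⟩
        0#                               ∎
      ⟨^·ᵥx,x⟩≈0 (suc (suc d)) x = begin
        ⟨ A ^ suc (suc d) ·ᵥ y , x ⟩  ≡⟨ ≡.cong ⟨_, x ⟩ (iterate-sucʳ (A ·ᵥ_) y (suc d)) ⟩
        ⟨ A ·ᵥ A ^ suc d ·ᵥ y , x ⟩   ≈⟨ ⟨·ᵥ,⟩≈⟨,·ᵥ⟩ A-sym (A ^ suc d ·ᵥ y) x ⟩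
        ⟨ A ^ suc d ·ᵥ y , y ⟩        ≈⟨ ⟨^·ᵥx,x⟩≈0 d y ⟩
        0#                            ∎
        where
        y : Vector Carrier n
        y = A ·ᵥ x

      module _ (l : ℕ) (v : Fin n → Vector Carrier n)
               (v-chain : ∀ i j → toℕ j ≡ suc (toℕ i) → toℕ j < l → A ·ᵥ v j ≋ᵥ v i) where

        chain-power : ∀ d i j → d ℕ.+ toℕ i ≡ toℕ j → toℕ j < l → A ^ d ·ᵥ v j ≋ᵥ v i
        chain-power zero    i j i≡j j<l r = reflexive (≡.cong (λ k → v k r) (toℕ-injective (≡.sym i≡j)))
        chain-power (suc d) i j d+1+i≡j j<l r =
          trans (^·ᵥ-congʳ A d (v-chain k j j≡1+k j<l) r) (chain-power d i k (≡.sym (toℕ-fromℕ< k<n)) k<l r)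
          where
          k<n : d ℕ.+ toℕ i < n
          k<n = ℕ.<⇒≤ (≡.subst (_< n) (≡.sym d+1+i≡j) (toℕ<n j))
          k : Fin n
          k = fromℕ< k<n
          j≡1+k : toℕ j ≡ suc (toℕ k)
          j≡1+k = ≡.trans (≡.sym d+1+i≡j) (≡.cong suc (≡.sym (toℕ-fromℕ< k<n)))
          k<l : toℕ k < l
          k<l = ≡.subst (_< l) (≡.sym (toℕ-fromℕ< k<n)) (ℕ.<⇒≤ (≡.subst (_< l) (≡.sym d+1+i≡j) j<l))

        chain-orthogonal : ∀ i j → toℕ i < toℕ j → toℕ j < l → ⟨ v i , v j ⟩ ≈ 0#
        chain-orthogonal i j i<j j<l = begin
          ⟨ v i , v j ⟩
            ≈⟨ ⟨⟩-cong (sym ∘ chain-power (suc d) i j d+1+i≡j j<l) (λ _ → refl) ⟩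
          ⟨ A ^ suc d ·ᵥ v j , v j ⟩     ≈⟨ ⟨^·ᵥx,x⟩≈0 d (v j) ⟩
          0#                             ∎
          where
          d : ℕ
          d = toℕ j ℕ.∸ suc (toℕ i)
          d+1+i≡j : suc d ℕ.+ toℕ i ≡ toℕ j
          d+1+i≡j = ≡.trans (≡.sym (ℕ.+-suc d (toℕ i))) (ℕ.m∸n+n≡m i<j)

        module _ (n-even : 2 ∣ n) (v-leading : ∀ r k → toℕ k ≡ 0 → v k r ≈ 1#) where

          chain-sum≈0 : ∀ j → toℕ j < l → sum (v j) ≈ 0#
          chain-sum≈0 j j<l with ℕ.m≤n⇒m<n∨m≡n (z≤n {toℕ j})
          ... | inj₂ 0≡j = begin
            sum (v j)            ≈⟨ sum-cong-≋ (λ r → v-leading r j (≡.sym 0≡j)) ⟩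
            sum (replicate n 1#) ≈⟨ sum-replicate n ⟩
            n ·ℕ 1#              ≈⟨ even-·ℕ≈0 1# n-even ⟩
            0#                   ∎
          ... | inj₁ 0<j = begin
            sum (v j)            ≈⟨ ⟨ones,⟩≈sum (v j) ⟨
            ⟨ ones , v j ⟩       ≈⟨ ⟨⟩-cong (λ r → v-leading r i₀ i₀≡0) (λ _ → refl) ⟨
            ⟨ v i₀ , v j ⟩       ≈⟨ chain-orthogonal i₀ j (≡.subst (_< toℕ j) (≡.sym i₀≡0) 0<j) j<l ⟩
            0#                   ∎
            where
            0<n : 0 < n
            0<n = ℕ.<-trans 0<j (toℕ<n j)
            i₀ : Fin n
            i₀ = fromℕ< 0<n
            i₀≡0 : toℕ i₀ ≡ 0
            i₀≡0 = toℕ-fromℕ< 0<n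

          chain-norm≈0 : ∀ j → toℕ j < l → ⟨ v j , v j ⟩ ≈ 0#
          chain-norm≈0 j j<l = begin
            ⟨ v j , v j ⟩          ≈⟨ ⟨x,x⟩≈sum² (v j) ⟩
            sum (v j) * sum (v j)  ≈⟨ *-congʳ (chain-sum≈0 j j<l) ⟩
            0# * sum (v j)         ≈⟨ zeroˡ _ ⟩
            0#                     ∎

          chain-gram≈0 : ∀ i j → toℕ i < l → toℕ j < l → ⟨ v i , v j ⟩ ≈ 0#
          chain-gram≈0 i j i<l j<l with ℕ.<-cmp (toℕ i) (toℕ j)
          ... | tri< i<j _ _ = chain-orthogonal i j i<j j<l
          ... | tri≈ _ i≡j _ =
            ≡.subst (λ k → ⟨ v k , v j ⟩ ≈ 0#) (≡.sym (toℕ-injective i≡j)) (chain-norm≈0 j j<l)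
          ... | tri> _ _ j<i = trans (⟨⟩-comm (v i) (v j)) (chain-orthogonal j i j<i i<l)

    leading-jordan-block-gram≈0 :
      ∀ {n} → 2 ∣ n → (A P : Matrix n n) →
      (∀ i j → A i j ≈ A j i) → (∀ i → A i i ≈ 0#) → (∀ i → (A ·ᵥ ones) i ≈ 0#) →
      ∀ l λ′ bs → (A ⊗ P) ≋ (P ⊗ jordanMatrix ((l , λ′) ∷ bs)) →
      (∀ r k → toℕ k ≡ 0 → P r k ≈ 1#) →
      ∀ a b → toℕ a < l → toℕ b < l → (transpose P ⊗ P) a b ≈ 0#
    leading-jordan-block-gram≈0 n-even A P A-sym A-diag Ae≈0 l λ′ bs AP≋PJ leading-ones a b a<l b<l = begin
      (transpose P ⊗ P) a b        ≈⟨ transpose-⊗-gram P a b ⟩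
      ⟨ column P a , column P b ⟩
        ≈⟨ chain-gram≈0 A A-sym A-diag Ae≈0 l (column P) chain n-even leading-ones a b a<l b<l ⟩
      0#                           ∎
      where
      λ′≈0 : λ′ ≈ 0#
      λ′≈0 = jordan-leading-eigenvalue≈0 A P l λ′ bs AP≋PJ Ae≈0 leading-ones
               (ℕ.≤-<-trans z≤n (toℕ<n a)) (ℕ.≤-<-trans z≤n a<l)
      chain : ∀ i j → toℕ j ≡ suc (toℕ i) → toℕ j < l → A ·ᵥ column P j ≋ᵥ column P i
      chain = jordan-chain A P l λ′ bs AP≋PJ λ′≈0

lemma11 : ∀ {c ℓ} (F : Field c ℓ) → HasChar2 F →
          let open Field F
              open Matrices F
          in (n : ℕ) → 2 ∣ n → (G : SimpleGraph n) → Eulerian G →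
             (P : Matrix n n) → Invertible P →
             (ℓ₁ : ℕ) (λ₁ : Carrier) (rest : List (ℕ × Carrier)) →
             ValidBlocks n ((ℓ₁ , λ₁) ∷ rest) →
             (adjMatrix G ⊗ P) ≋ (P ⊗ jordanMatrix ((ℓ₁ , λ₁) ∷ rest)) →
             (∀ (r k : Fin n) → toℕ k ≡ 0 → P r k ≈ 1#) →
             ∀ (a b : Fin n) → toℕ a < ℓ₁ → toℕ b < ℓ₁ →
             (transpose P ⊗ P) a b ≈ 0#
lemma11 F char2 n n-even G eulerian P _ ℓ₁ λ₁ rest _ =
  leading-jordan-block-gram≈0 F char2 n-even (Matrices.adjMatrix F G) P
    (adjMatrix-symmetric F G) (adjMatrix-diagonal F G) (eulerian-row-sum≈0 F char2 G eulerian) ℓ₁ λ₁ rest
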